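{- Let $A,K$ be integers with either ($A\ge 3$ and ($K=3$ or $K\ge 5$)) or ($A=2$ and $K\ge 6$). Put $a=K$, $b=A^2K-4A$, $c=(A+1)^2K-4(A+1)$. Let $\rho$ be a positive integer. If $AK\ge 2\rho+4$, then \[ c-a\le b+\frac{(2\rho+2)b}{\rho A}. \] -}

module Defs where

open import Data.Nat using (ℕ; suc; _≤_; s≤s)
open import Data.Integer using (ℤ; +_; _+_; _-_; _*_)
open import Data.Rational using (ℚ; _/_)
import Data.Rational

aOf : ℕ → ℕ → ℤ
aOf A K = + K

bOf : ℕ → ℕ → ℤ
bOf A K = (+ A) * (+ A) * (+ K) - (+ 4) * (+ A)

cOf : ℕ → ℕ → ℤ
cOf A K = (+ A + + 1) * (+ A + + 1) * (+ K) - (+ 4) * (+ A + + 1)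

-- the rational number n / d; d = 0 gives junk value 0 (never used: d = ρA ≥ 2 in the statement)
frac : ℤ → ℕ → ℚ
frac n 0 = Data.Rational.0ℚ
frac n (suc d) = n / suc d

{-# OPTIONS --safe #-}
-- Clearing the positive denominator ρA, the claim becomes (c − a)ρA ≤ bρA + (2ρ + 2)b.
-- The two sides differ by exactly 2A(AK − 2ρ − 4), which is nonnegative by hypothesis.
module Submission where

open import Defs
open import Data.Nat using (ℕ; _≤_; _*_; _+_; suc; zero; z≤n)
open import Data.Sum using (_⊎_)
open import Data.Product using (_×_)
open import Relation.Binary.PropositionalEquality
open import Data.Nat.Properties using (*-identityˡ)
import Data.Integer as Z
import Data.Integer.Properties as ZP
open import Data.Integer.Tactic.RingSolver using (solve-∀)
import Data.Rational as Q
import Data.Rational.Properties as QP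
import Data.Rational.Unnormalised as U
import Data.Rational.Unnormalised.Properties as UP

fromℚᵘ-mono-≤ : ∀ {p q} → p U.≤ q → Q.fromℚᵘ p Q.≤ Q.fromℚᵘ q
fromℚᵘ-mono-≤ {p} {q} p≤q = QP.toℚᵘ-cancel-≤
  (UP.≤-respˡ-≃ (UP.≃-sym (QP.toℚᵘ-fromℚᵘ p)) (UP.≤-respʳ-≃ (UP.≃-sym (QP.toℚᵘ-fromℚᵘ q)) p≤q))

fromℚᵘ-homo-+ : ∀ p q → Q.fromℚᵘ (p U.+ q) ≡ Q.fromℚᵘ p Q.+ Q.fromℚᵘ q
fromℚᵘ-homo-+ p q = begin
  Q.fromℚᵘ (p U.+ q)
    ≡⟨ QP.fromℚᵘ-cong (UP.+-cong (UP.≃-sym (QP.toℚᵘ-fromℚᵘ p)) (UP.≃-sym (QP.toℚᵘ-fromℚᵘ q))) ⟩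
  Q.fromℚᵘ (Q.toℚᵘ (Q.fromℚᵘ p) U.+ Q.toℚᵘ (Q.fromℚᵘ q))
    ≡⟨ QP.fromℚᵘ-cong (UP.≃-sym (QP.toℚᵘ-homo-+ (Q.fromℚᵘ p) (Q.fromℚᵘ q))) ⟩
  Q.fromℚᵘ (Q.toℚᵘ (Q.fromℚᵘ p Q.+ Q.fromℚᵘ q))
    ≡⟨ QP.fromℚᵘ-toℚᵘ _ ⟩
  Q.fromℚᵘ p Q.+ Q.fromℚᵘ q ∎
  where open ≡-Reasoning

fromℚᵘ-homo‿- : ∀ p → Q.fromℚᵘ (U.- p) ≡ Q.- Q.fromℚᵘ p
fromℚᵘ-homo‿- p = begin
  Q.fromℚᵘ (U.- p)                     ≡⟨ QP.fromℚᵘ-cong (UP.-‿cong (UP.≃-sym (QP.toℚᵘ-fromℚᵘ p))) ⟩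
  Q.fromℚᵘ (U.- Q.toℚᵘ (Q.fromℚᵘ p))  ≡⟨ QP.fromℚᵘ-cong (UP.≃-sym (QP.toℚᵘ-homo‿- (Q.fromℚᵘ p))) ⟩
  Q.fromℚᵘ (Q.toℚᵘ (Q.- Q.fromℚᵘ p))  ≡⟨ QP.fromℚᵘ-toℚᵘ _ ⟩
  Q.- Q.fromℚᵘ p                       ∎
  where open ≡-Reasoning

fromℚᵘ-homo-- : ∀ p q → Q.fromℚᵘ (p U.- q) ≡ Q.fromℚᵘ p Q.- Q.fromℚᵘ q
fromℚᵘ-homo-- p q = trans (fromℚᵘ-homo-+ p (U.- q)) (cong (Q.fromℚᵘ p Q.+_) (fromℚᵘ-homo‿- q))

≤ᵘ-clear-denominators : ∀ x y z w d →
  (x Z.- y) Z.* Z.+ suc d Z.≤ z Z.* Z.+ suc d Z.+ w →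
  U.mkℚᵘ x 0 U.- U.mkℚᵘ y 0 U.≤ U.mkℚᵘ z 0 U.+ U.mkℚᵘ w d
≤ᵘ-clear-denominators x y z w d h = U.*≤* (subst₂ Z._≤_ lhs rhs h)
  where
  lhs : (x Z.- y) Z.* Z.+ suc d ≡ (x Z.* Z.+ 1 Z.+ Z.- y Z.* Z.+ 1) Z.* Z.+ (1 * suc d)
  lhs = cong₂ Z._*_ (cong₂ Z._+_ (sym (ZP.*-identityʳ x)) (sym (ZP.*-identityʳ (Z.- y))))
                    (cong Z.+_ (sym (*-identityˡ (suc d))))
  rhs : z Z.* Z.+ suc d Z.+ w ≡ (z Z.* Z.+ suc d Z.+ w Z.* Z.+ 1) Z.* Z.+ 1
  rhs = sym (trans (ZP.*-identityʳ _) (cong (Z._+_ (z Z.* Z.+ suc d)) (ZP.*-identityʳ w)))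

pos-*-+ : ∀ m n k → Z.+ (m * n + k) ≡ Z.+ m Z.* Z.+ n Z.+ Z.+ k
pos-*-+ m n k = trans (ZP.pos-+ (m * n) k) (cong (Z._+ Z.+ k) (ZP.pos-* m n))

0≤i⇒0≤j⇒0≤i*j : ∀ {i j} → Z.0ℤ Z.≤ i → Z.0ℤ Z.≤ j → Z.0ℤ Z.≤ i Z.* j
0≤i⇒0≤j⇒0≤i*j {i} {j} 0≤i 0≤j =
  subst (Z._≤ i Z.* j) (ZP.*-zeroʳ i) (ZP.*-monoˡ-≤-nonNeg i {{Z.nonNegative 0≤i}} 0≤j)

b[ρA]+[2ρ+2]b≡[c-a][ρA]+2A[AK-2ρ-4] : ∀ A K ρ →
  (A Z.* A Z.* K Z.- Z.+ 4 Z.* A) Z.* (ρ Z.* A) Z.+ (Z.+ 2 Z.* ρ Z.+ Z.+ 2) Z.* (A Z.* A Z.* K Z.- Z.+ 4 Z.* A)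
  ≡ ((A Z.+ Z.+ 1) Z.* (A Z.+ Z.+ 1) Z.* K Z.- Z.+ 4 Z.* (A Z.+ Z.+ 1) Z.- K) Z.* (ρ Z.* A)
    Z.+ (Z.+ 2 Z.* A) Z.* (A Z.* K Z.- (Z.+ 2 Z.* ρ Z.+ Z.+ 4))
b[ρA]+[2ρ+2]b≡[c-a][ρA]+2A[AK-2ρ-4] = solve-∀

[c-a]ρA≤bρA+[2ρ+2]b : ∀ A K ρ → 2 * ρ + 4 ≤ A * K →
  (cOf A K Z.- aOf A K) Z.* Z.+ (ρ * A) Z.≤ bOf A K Z.* Z.+ (ρ * A) Z.+ Z.+ (2 * ρ + 2) Z.* bOf A K
[c-a]ρA≤bρA+[2ρ+2]b A K ρ 2ρ+4≤AK = begin
  (cOf A K Z.- aOf A K) Z.* Z.+ (ρ * A)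
    ≡⟨ cong (Z._*_ (cOf A K Z.- aOf A K)) (ZP.pos-* ρ A) ⟩
  (cOf A K Z.- aOf A K) Z.* (Z.+ ρ Z.* Z.+ A)
    ≤⟨ ZP.i≤i+j _ gap {{Z.nonNegative gap≥0}} ⟩
  (cOf A K Z.- aOf A K) Z.* (Z.+ ρ Z.* Z.+ A) Z.+ gap
    ≡⟨ b[ρA]+[2ρ+2]b≡[c-a][ρA]+2A[AK-2ρ-4] (Z.+ A) (Z.+ K) (Z.+ ρ) ⟨
  bOf A K Z.* (Z.+ ρ Z.* Z.+ A) Z.+ (Z.+ 2 Z.* Z.+ ρ Z.+ Z.+ 2) Z.* bOf A K
    ≡⟨ cong₂ (λ n m → bOf A K Z.* n Z.+ m Z.* bOf A K) (ZP.pos-* ρ A) (pos-*-+ 2 ρ 2) ⟨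
  bOf A K Z.* Z.+ (ρ * A) Z.+ Z.+ (2 * ρ + 2) Z.* bOf A K ∎
  where
  open ZP.≤-Reasoning
  gap : Z.ℤ
  gap = (Z.+ 2 Z.* Z.+ A) Z.* (Z.+ A Z.* Z.+ K Z.- (Z.+ 2 Z.* Z.+ ρ Z.+ Z.+ 4))
  gap≥0 : Z.0ℤ Z.≤ gap
  gap≥0 = 0≤i⇒0≤j⇒0≤i*j (subst (Z.0ℤ Z.≤_) (ZP.pos-* 2 A) (Z.+≤+ z≤n))
            (ZP.i≤j⇒0≤j-i (subst₂ Z._≤_ (pos-*-+ 2 ρ 4) (ZP.pos-* A K) (Z.+≤+ 2ρ+4≤AK)))

frac-sub-frac-≤-frac-add-frac : ∀ x y z w d →
  (x Z.- y) Z.* Z.+ suc d Z.≤ z Z.* Z.+ suc d Z.+ w →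
  frac x 1 Q.- frac y 1 Q.≤ frac z 1 Q.+ frac w (suc d)
frac-sub-frac-≤-frac-add-frac x y z w d h =
  subst₂ Q._≤_ (fromℚᵘ-homo-- (U.mkℚᵘ x 0) (U.mkℚᵘ y 0)) (fromℚᵘ-homo-+ (U.mkℚᵘ z 0) (U.mkℚᵘ w d))
    (fromℚᵘ-mono-≤ (≤ᵘ-clear-denominators x y z w d h))

lemma3p8 : (A K : ℕ) →
    ((3 ≤ A × (K ≡ 3 ⊎ 5 ≤ K)) ⊎ (A ≡ 2 × 6 ≤ K)) →
    (ρ : ℕ) → 1 ≤ ρ →
    2 * ρ + 4 ≤ A * K →
    Q._≤_ (frac (cOf A K) 1 Q.- frac (aOf A K) 1)
          (frac (bOf A K) 1 Q.+ frac ((Z.+ (2 * ρ + 2)) Z.* bOf A K) (ρ * A))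
lemma3p8 A    K _ zero    ()
lemma3p8 zero K _ (suc _) _ ()
lemma3p8 A@(suc A-1) K _ ρ@(suc ρ-1) _ 2ρ+4≤AK =
  -- ρ * A reduces to suc (A-1 + ρ-1 * A), so frac sees a nonzero denominator
  frac-sub-frac-≤-frac-add-frac (cOf A K) (aOf A K) (bOf A K) (Z.+ (2 * ρ + 2) Z.* bOf A K)
    (A-1 + ρ-1 * A) ([c-a]ρA≤bρA+[2ρ+2]b A K ρ 2ρ+4≤AK)
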